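{- Let $\Lambda$ be a finite set, let $\mathcal{A}$ be a point based function array over a semigroup $A$ indexed by $\Lambda$, and let $\mathcal{S}$ be a function array over a partial semigroup $S$ indexed by $\Lambda$ and based on $X$. Let $(f,g)\colon\mathcal{A}\to\gamma\mathcal{S}$ be a homomorphism and let $F$ be a finite subset of $A$. Then for each $D\in f(\bullet)$ and each coloring of $S$ with finitely many colors, there exists a basic sequence $(x_n)$ in $\mathcal{S}$ of elements of $D$ on which the coloring is $F$-$\mathcal{A}$-tame.
   Context: Partial semigroup: partially defined associative operation. A function array over $S$ indexed by $\Lambda$ based on $X$: each $\lambda$ a partial function $X\to S$ such that for all $s_0,\dots,s_k\in S$ some $x$ has $s_i\lambda(x)$ defined for all $i,\lambda$; point based means $X=\{\bullet\}$. $\gamma S$: ultrafilters $\mathcal{U}$ on $S$ with $\{t: st\text{ defined}\}\in\mathcal{U}$ for all $s$, with $B\in\mathcal{U}*\mathcal{V}$ iff $\{s:\{t: st\text{ defined}, st\in B\}\in\mathcal{V}\}\in\mathcal{U}$. $\gamma X$: ultrafilters on $X$ containing $\{x: s\lambda(x)\text{ defined}\}$ for all $s,\lambda$; $\lambda$ extends via $B\in\lambda(\mathcal{U})$ iff $\lambda^{ -1}(B)\in\mathcal{U}$, giving the total array $\gamma\mathcal{S}$. A homomorphism $(f,g)$ between total arrays: $f$ between base sets, $g$ a semigroup homomorphism, $\lambda(f(y))=g(\lambda(y))$. A sequence $(x_n)$ in $X$ is basic if $\lambda_0(x_{n_0})\cdots\lambda_l(x_{n_l})$ is defined for all $n_0<\dots<n_l$,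 $\lambda_i\in\Lambda$. With $\vee$ the operation of $A$, a coloring of $S$ is $F$-$\mathcal{A}$-tame on a basic $(x_n)$ if the color of $\lambda_0(x_{n_0})\cdots\lambda_l(x_{n_l})$ ($n_0<\dots<n_l$), among those with $\lambda_k(\bullet)\vee\cdots\vee\lambda_l(\bullet)\in F$ for every $k\leq l$, depends only on $\lambda_0(\bullet)\vee\cdots\vee\lambda_l(\bullet)$. -}

module Defs where

open import Data.Nat using (ℕ; _<_)
open import Data.Fin using (Fin)
open import Data.Maybe using (Maybe; just; nothing; _>>=_)
open import Data.List using (List)
open import Data.List.NonEmpty using (List⁺; _∷_)
open import Data.List.Relation.Unary.All using (All)
open import Data.List.Membership.Propositional using (_∈_)
open import Data.Product using (Σ; ∃; _×_; proj₁; proj₂)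
open import Data.Sum using (_⊎_)
open import Data.Unit using (⊤)
open import Relation.Nullary using (¬_)
open import Relation.Binary.PropositionalEquality using (_≡_)
open import Function.Bundles using (_⇔_)

record Semigroup : Set₁ where
  infixl 7 _∨_
  field
    Carrier : Set
    _∨_     : Carrier → Carrier → Carrier
    assoc   : ∀ a b c → (a ∨ b) ∨ c ≡ a ∨ (b ∨ c)

-- Partial semigroup: partial operation (Maybe-valued), associative in the
-- strong sense: (st)u is defined iff s(tu) is, and then they agree.
record PartialSemigroup : Set₁ where
  infixl 7 _·_
  field
    Carrier : Set
    _·_     : Carrier → Carrier → Maybe Carrier
    assoc   : ∀ s t u →
              ((s · t) >>= λ v → v · u) ≡ ((t · u) >>= λ v → s · v)

module _ (S : PartialSemigroup) where
  open PartialSemigroup S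

  Defined : Carrier → Carrier → Set
  Defined s t = ∃ λ u → s · t ≡ just u

  DefinedApp : Carrier → Maybe Carrier → Set
  DefinedApp s mt = ∃ λ t → mt ≡ just t × Defined s t

record FunctionArray (S : PartialSemigroup) (m : ℕ) : Set₁ where
  open PartialSemigroup S
  field
    Base  : Set
    fun   : Fin m → Base → Maybe Carrier
    cover : ∀ (ss : List Carrier) →
            ∃ λ x → All (λ s → ∀ l → DefinedApp S s (fun l x)) ss

-- A point based function array over a semigroup A indexed by Fin m:
-- each λ is a (total) function {•} → A, i.e. an element λ(•) of A.
PointArray : Semigroup → ℕ → Set
PointArray A m = Fin m → Semigroup.Carrier A

record Ultrafilter (X : Set) : Set₁ where
  field
    mem       : (X → Set) → Set
    up        : ∀ {B C : X → Set} → mem B → (∀ x → B x → C x) → mem C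
    inter     : ∀ {B C : X → Set} → mem B → mem C → mem (λ x → B x × C x)
    inhabited : ∀ {B : X → Set} → mem B → ∃ B
    ultra     : ∀ (B : X → Set) → mem B ⊎ mem (λ x → ¬ B x)
open Ultrafilter public

record GammaS (S : PartialSemigroup) : Set₁ where
  open PartialSemigroup S
  field
    ult     : Ultrafilter Carrier
    cofinal : ∀ s → mem ult (λ t → Defined S s t)
open GammaS public

MulMem : (S : PartialSemigroup) → GammaS S → GammaS S →
         (PartialSemigroup.Carrier S → Set) → Set
MulMem S U V B = mem (ult U) (λ s → mem (ult V)
                   (λ t → ∃ λ u → PartialSemigroup._·_ S s t ≡ just u × B u))

record GammaX {S : PartialSemigroup} {m : ℕ} (𝒮 : FunctionArray S m) : Set₁ where
  open FunctionArray 𝒮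
  field
    ultX    : Ultrafilter Base
    adapted : ∀ s l → mem ultX (λ x → DefinedApp S s (fun l x))
open GammaX public

-- membership in λ(U) for U ∈ γX: B ∈ λ(U) iff λ⁻¹(B) ∈ U
ExtMem : {S : PartialSemigroup} {m : ℕ} (𝒮 : FunctionArray S m) →
         Fin m → GammaX 𝒮 → (PartialSemigroup.Carrier S → Set) → Set
ExtMem 𝒮 l U B =
  mem (ultX U) (λ x → ∃ λ t → FunctionArray.fun 𝒮 l x ≡ just t × B t)

-- Homomorphism (f , g) : 𝒜 → γ𝒮, where f(•) = point
record Homomorphism (A : Semigroup) {m : ℕ} (𝒜 : PointArray A m)
                    {S : PartialSemigroup} (𝒮 : FunctionArray S m) : Set₁ where
  open Semigroup A
  field
    point : GammaX 𝒮
    g     : Carrier → GammaS S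
    g-hom : ∀ a b (B : PartialSemigroup.Carrier S → Set) →
            mem (ult (g (a ∨ b))) B ⇔ MulMem S (g a) (g b) B
    compat : ∀ l (B : PartialSemigroup.Carrier S → Set) →
             ExtMem 𝒮 l point B ⇔ mem (ult (g (𝒜 l))) B
open Homomorphism public

-- Words λ₀(x_{n₀}) ⋯ λ_l(x_{n_l}) : nonempty lists of (n_i , λ_i)

IncreasingFrom : ∀ {m} → ℕ × Fin m → List (ℕ × Fin m) → Set
IncreasingFrom p List.[] = ⊤
IncreasingFrom p (q List.∷ r) = proj₁ p < proj₁ q × IncreasingFrom q r

Increasing : ∀ {m} → List⁺ (ℕ × Fin m) → Set
Increasing (p ∷ r) = IncreasingFrom p r

module _ {S : PartialSemigroup} {m : ℕ} (𝒮 : FunctionArray S m) where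
  open PartialSemigroup S
  open FunctionArray 𝒮

  evalS′ : (ℕ → Base) → ℕ × Fin m → List (ℕ × Fin m) → Maybe Carrier
  evalS′ x p List.[] = fun (proj₂ p) (x (proj₁ p))
  evalS′ x p (q List.∷ r) =
    fun (proj₂ p) (x (proj₁ p)) >>= λ s → evalS′ x q r >>= λ t → s · t

  evalS : (ℕ → Base) → List⁺ (ℕ × Fin m) → Maybe Carrier
  evalS x (p ∷ r) = evalS′ x p r

  Basic : (ℕ → Base) → Set
  Basic x = ∀ (w : List⁺ (ℕ × Fin m)) → Increasing w →
            ∃ λ s → evalS x w ≡ just s

module _ (A : Semigroup) {m : ℕ} (𝒜 : PointArray A m) where
  open Semigroup A

  evalA′ : ℕ × Fin m → List (ℕ × Fin m) → Carrier
  evalA′ p List.[] = 𝒜 (proj₂ p)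
  evalA′ p (q List.∷ r) = 𝒜 (proj₂ p) ∨ evalA′ q r

  evalA : List⁺ (ℕ × Fin m) → Carrier
  evalA (p ∷ r) = evalA′ p r

  SuffixesIn′ : List Carrier → ℕ × Fin m → List (ℕ × Fin m) → Set
  SuffixesIn′ F p List.[] = evalA′ p List.[] ∈ F
  SuffixesIn′ F p (q List.∷ r) = evalA′ p (q List.∷ r) ∈ F × SuffixesIn′ F q r

  SuffixesIn : List Carrier → List⁺ (ℕ × Fin m) → Set
  SuffixesIn F (p ∷ r) = SuffixesIn′ F p r

Tame : (A : Semigroup) {m : ℕ} (𝒜 : PointArray A m)
       {S : PartialSemigroup} (𝒮 : FunctionArray S m) →
       List (Semigroup.Carrier A) → {r : ℕ} →
       (PartialSemigroup.Carrier S → Fin r) →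
       (ℕ → FunctionArray.Base 𝒮) → Set
Tame A {m} 𝒜 𝒮 F c x =
  ∀ (w w′ : List⁺ (ℕ × Fin m)) → Increasing w → Increasing w′ →
  SuffixesIn A 𝒜 F w → SuffixesIn A 𝒜 F w′ →
  evalA A 𝒜 w ≡ evalA A 𝒜 w′ →
  ∀ s s′ → evalS 𝒮 x w ≡ just s → evalS 𝒮 x w′ ≡ just s′ → c s ≡ c s′

-- Build x₀, x₁, … one at a time, each chosen from the ultrafilter f(•) inside D.
-- Alongside, keep for every b ∈ F a set C_n(b) ∈ g(b) containing the value of every
-- word with first index ≥ n, suffix values in F and A-value b; C₀(b) is the g(b)-large
-- colour class, so C₀ already makes the colouring tame.  Since λ(f(•)) = g(λ(•)) and
-- g(λ(•) ∨ b) = g(λ(•)) * g(b), the x with λ(x) ∈ C_n(λ(•)) and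
-- {t : λ(x)t ∈ C_n(λ(•) ∨ b)} ∈ g(b) form a member of f(•); C_{n+1}(b) refines C_n(b)
-- by the finitely many g(b)-large sets {t : λ(x_n)t ∈ C_n(λ(•) ∨ b)}.  A finite list of
-- left factors that later values must accept keeps the sequence basic.
module Submission where

open import Defs
open import Data.Nat using (ℕ; zero; suc; _≤_; z≤n; _≤′_; ≤′-refl; ≤′-step)
open import Data.Nat.Properties using (≤⇒≤′)
open import Data.Fin using (Fin)
open import Data.Fin.Properties using (any?)
open import Data.List using (List; []; _∷_; _++_; concat; tabulate; allFin)
open import Data.List.NonEmpty using (_∷_)
open import Data.List.Relation.Unary.All using (All; []; _∷_)
open import Data.List.Relation.Unary.All.Properties using (++⁻ˡ; ++⁻ʳ; concat⁻; tabulate⁻)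
open import Data.List.Relation.Unary.Any using (here; there)
open import Data.List.Membership.Propositional using (_∈_)
open import Data.List.Membership.Propositional.Properties using (∈-allFin)
open import Data.Maybe using (Maybe; just; _>>=_)
open import Data.Maybe.Properties using (just-injective)
open import Data.Product using (∃; _×_; _,_; proj₁; proj₂)
open import Data.Sum using (_⊎_; inj₁; inj₂)
open import Data.Unit using (⊤; tt)
open import Data.Empty using (⊥-elim)
open import Relation.Nullary using (¬_; Dec; yes; no)
open import Relation.Binary.PropositionalEquality using (_≡_; refl; sym; trans; cong; subst; module ≡-Reasoning)
open import Function.Bundles using (Equivalence)

module _ {X : Set} (V : Ultrafilter X) where

  -- Applying ultra to a constant predicate decides any proposition.
  excluded-middle : (Q : Set) → Q ⊎ ¬ Q
  excluded-middle Q with ultra V (λ _ → Q)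
  ... | inj₁ M = inj₁ (proj₂ (inhabited V M))
  ... | inj₂ M = inj₂ (proj₂ (inhabited V M))

  mem-⊤ : mem V (λ _ → ⊤)
  mem-⊤ with ultra V (λ _ → ⊤)
  ... | inj₁ M = M
  ... | inj₂ M = ⊥-elim (proj₂ (inhabited V M) tt)

  mem-→ : (Q : Set) {R : X → Set} → (Q → mem V R) → mem V (λ x → Q → R x)
  mem-→ Q Q⇒R with excluded-middle Q
  ... | inj₁ q  = up V (Q⇒R q) (λ _ r _ → r)
  ... | inj₂ ¬q = up V mem-⊤ (λ _ _ q → ⊥-elim (¬q q))

  mem-∀∈ : ∀ {I : Set} (L : List I) {Q : I → X → Set} →
           (∀ i → i ∈ L → mem V (Q i)) → mem V (λ x → ∀ i → i ∈ L → Q i x)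
  mem-∀∈ []      M = up V mem-⊤ (λ _ _ _ ())
  mem-∀∈ (j ∷ L) M = up V (inter V (M j (here refl)) (mem-∀∈ L (λ i i∈L → M i (there i∈L))))
    λ { _ (q , qs) _ (here refl) → q ; _ (q , qs) i (there i∈L) → qs i i∈L }

  mem-∀ : ∀ {k} {Q : Fin k → X → Set} → (∀ i → mem V (Q i)) → mem V (λ x → ∀ i → Q i x)
  mem-∀ {k} M = up V (mem-∀∈ (allFin k) (λ i _ → M i)) (λ _ q i → q i (∈-allFin i))

  mem? : (B : X → Set) → Dec (mem V B)
  mem? B with ultra V B
  ... | inj₁ M = yes M
  ... | inj₂ M = no λ M′ → let (_ , b , ¬b) = inhabited V (inter V M′ M) in ¬b b

  large-colour-class : ∀ {r} (c : X → Fin r) → ∃ λ i → mem V (λ x → c x ≡ i)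
  large-colour-class c with any? (λ i → mem? (λ x → c x ≡ i))
  ... | yes found = found
  ... | no none   = ⊥-elim (let (x , ≢c) = inhabited V avoids-all in ≢c (c x) refl)
    where
    small : ∀ i → mem V (λ x → ¬ c x ≡ i)
    small i with ultra V (λ x → c x ≡ i)
    ... | inj₁ M = ⊥-elim (none (i , M))
    ... | inj₂ M = M

    avoids-all : mem V (λ x → ∀ i → ¬ c x ≡ i)
    avoids-all = mem-∀ small

module _ (S : PartialSemigroup) where
  open PartialSemigroup S

  ·-assoc-just : ∀ {s t v u w z} → s · t ≡ just u → t · v ≡ just w → u · v ≡ just z →
                 s · w ≡ just z
  ·-assoc-just {s} {t} {v} {u} {w} {z} st tv uv = begin
    s · w              ≡⟨ cong (_>>= s ·_) tv ⟨
    (t · v >>= s ·_)   ≡⟨ assoc s t v ⟨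
    (s · t >>= _· v)   ≡⟨ cong (_>>= _· v) st ⟩
    u · v              ≡⟨ uv ⟩
    just z             ∎
    where open ≡-Reasoning

  AllDefined : List Carrier → Carrier → Set
  AllDefined ss t = All (λ s → Defined S s t) ss

  products : ∀ {ss t} → AllDefined ss t → List Carrier
  products []             = []
  products ((u , _) ∷ ds) = u ∷ products ds

  AllDefined-assoc : ∀ {ss t v w} (ds : AllDefined ss t) → t · v ≡ just w →
                     AllDefined (products ds) v → AllDefined ss w
  AllDefined-assoc []              tv []               = []
  AllDefined-assoc ((_ , st) ∷ ds) tv ((z , uv) ∷ dvs) =
    (z , ·-assoc-just st tv uv) ∷ AllDefined-assoc ds tv dvs

module Construction {m : ℕ} (A : Semigroup) (𝒜 : PointArray A m)
    (S : PartialSemigroup) (𝒮 : FunctionArray S m) (h : Homomorphism A 𝒜 𝒮)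
    (F : List (Semigroup.Carrier A)) (D : FunctionArray.Base 𝒮 → Set)
    (D∈f• : mem (ultX (point h)) D) {r : ℕ} (c : PartialSemigroup.Carrier S → Fin r)
    where

  open Semigroup A using (_∨_) renaming (Carrier to AC)
  open PartialSemigroup S using (_·_) renaming (Carrier to SC)
  open FunctionArray 𝒮 using (Base; fun)

  f• : Ultrafilter Base
  f• = ultX (point h)

  G : AC → Ultrafilter SC
  G a = ult (g h a)

  MultipliableBy : List SC → Maybe SC → Set
  MultipliableBy ss mt = ∃ λ t → mt ≡ just t × AllDefined S ss t

  record Stage : Set₁ where
    field
      class       : AC → SC → Set
      class-large : ∀ b → b ∈ F → mem (G b) (class b)
      multipliers : List SC
  open Stage

  InClass : Stage → Fin m → Base → Set
  InClass σ l x = 𝒜 l ∈ F → ∃ λ t → fun l x ≡ just t × class σ (𝒜 l) t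

  Extendable : Stage → Fin m → Base → Set
  Extendable σ l x = ∀ b → b ∈ F → 𝒜 l ∨ b ∈ F → ∃ λ s → fun l x ≡ just s ×
                       mem (G b) (λ t → ∃ λ u → s · t ≡ just u × class σ (𝒜 l ∨ b) u)

  record Good (σ : Stage) (x : Base) : Set where
    field
      multipliable : ∀ l → MultipliableBy (multipliers σ) (fun l x)
      in-class     : ∀ l → InClass σ l x
      extendable   : ∀ l → Extendable σ l x
  open Good

  multipliable-mem : ∀ l ss → mem f• (λ x → MultipliableBy ss (fun l x))
  multipliable-mem l [] =
    up f• (adapted (point h) s l) (λ _ (t , e , _) → t , e , [])
    where s = proj₁ (inhabited (G (𝒜 l)) (mem-⊤ (G (𝒜 l))))
  multipliable-mem l (s ∷ ss) =
    up f• (inter f• (adapted (point h) s l) (multipliable-mem l ss))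
      λ { _ ((t , e , d) , (t′ , e′ , ds)) →
            t , e , d ∷ subst (AllDefined S ss) (just-injective (trans (sym e′) e)) ds }

  good-mem : ∀ σ → mem f• (Good σ)
  good-mem σ = up f• (inter f• (mem-∀ f• (λ l → multipliable-mem l (multipliers σ)))
                       (inter f• (mem-∀ f• in-class-mem) (mem-∀ f• extendable-mem)))
    λ _ (p , q , e) → record { multipliable = p ; in-class = q ; extendable = e }
    where
    in-class-mem : ∀ l → mem f• (InClass σ l)
    in-class-mem l = mem-→ f• (𝒜 l ∈ F) λ 𝒜l∈F →
      Equivalence.from (compat h l _) (class-large σ (𝒜 l) 𝒜l∈F)

    extendable-mem : ∀ l → mem f• (Extendable σ l)
    extendable-mem l = mem-∀∈ f• F λ b _ → mem-→ f• (𝒜 l ∨ b ∈ F) λ 𝒜l∨b∈F →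
      Equivalence.from (compat h l _)
        (Equivalence.to (g-hom h (𝒜 l) b _) (class-large σ (𝒜 l ∨ b) 𝒜l∨b∈F))

  good-in-D : ∀ σ → ∃ λ x → D x × Good σ x
  good-in-D σ = inhabited f• (inter f• D∈f• (good-mem σ))

  pick : Stage → Base
  pick σ = proj₁ (good-in-D σ)

  pick∈D : ∀ σ → D (pick σ)
  pick∈D σ = proj₁ (proj₂ (good-in-D σ))

  pick-good : ∀ σ → Good σ (pick σ)
  pick-good σ = proj₂ (proj₂ (good-in-D σ))

  -- λ_l(x) and its products with the old multipliers must all multiply later values.
  new-multipliers : ∀ σ → Fin m → List SC
  new-multipliers σ l = let (s , _ , ds) = multipliable (pick-good σ) l in s ∷ products S ds

  next : Stage → Stage
  next σ = record
    { class       = λ b t → class σ b t × ∀ l → 𝒜 l ∨ b ∈ F →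
                      ∃ λ v → (fun l (pick σ) >>= _· t) ≡ just v × class σ (𝒜 l ∨ b) v
    ; class-large = λ b b∈F → inter (G b) (class-large σ b b∈F) (mem-∀ (G b) λ l →
                      mem-→ (G b) (𝒜 l ∨ b ∈ F) λ 𝒜l∨b∈F →
                        let (s , e , M) = extendable (pick-good σ) l b b∈F 𝒜l∨b∈F in
                        up (G b) M λ t (u , st , u∈C) → u , trans (cong (_>>= _· t) e) st , u∈C)
    ; multipliers = multipliers σ ++ concat (tabulate (new-multipliers σ))
    }

  colour : AC → Fin r
  colour a = proj₁ (large-colour-class (G a) c)

  initial : Stage
  initial = record
    { class       = λ b t → c t ≡ colour b
    ; class-large = λ b _ → proj₂ (large-colour-class (G b) c)
    ; multipliers = []
    }

  stage : ℕ → Stage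
  stage zero    = initial
  stage (suc n) = next (stage n)

  x : ℕ → Base
  x n = pick (stage n)

  good : ∀ n → Good (stage n) (x n)
  good n = pick-good (stage n)

  class-shrink : ∀ {n k} → n ≤′ k → ∀ {b t} → class (stage k) b t → class (stage n) b t
  class-shrink ≤′-refl       t∈C = t∈C
  class-shrink (≤′-step n≤k) t∈C = class-shrink n≤k (proj₁ t∈C)

  multipliers-shrink : ∀ {n k} → n ≤′ k → ∀ {t} →
                       AllDefined S (multipliers (stage k)) t →
                       AllDefined S (multipliers (stage n)) t
  multipliers-shrink ≤′-refl                 ds = ds
  multipliers-shrink {k = suc k} (≤′-step n≤k) ds =
    multipliers-shrink n≤k (++⁻ˡ (multipliers (stage k)) ds)

  evalS′-∷ : ∀ k l q ws {t} → evalS′ 𝒮 x q ws ≡ just t →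
             evalS′ 𝒮 x (k , l) (q ∷ ws) ≡ (fun l (x k) >>= _· t)
  evalS′-∷ k l q ws e = cong (λ z → fun l (x k) >>= λ s → z >>= s ·_) e

  prepend-multipliable : ∀ k l {t} → AllDefined S (multipliers (stage (suc k))) t →
                         MultipliableBy (multipliers (stage k)) (fun l (x k) >>= _· t)
  prepend-multipliable k l ds with multipliable (good k) l
                                 | tabulate⁻ (concat⁻ (++⁻ʳ (multipliers (stage k)) ds)) l
  ... | s , e , old | (w , sw) ∷ dws =
    w , trans (cong (_>>= _· _) e) sw , AllDefined-assoc S old sw dws

  word-multipliable : ∀ n p ws → n ≤ proj₁ p → IncreasingFrom p ws →
                      MultipliableBy (multipliers (stage n)) (evalS′ 𝒮 x p ws)
  word-multipliable n (k , l) [] n≤k _ with multipliable (good k) l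
  ... | t , e , ds = t , e , multipliers-shrink (≤⇒≤′ n≤k) ds
  word-multipliable n (k , l) (q ∷ ws) n≤k (k<q , inc) with word-multipliable (suc k) q ws k<q inc
  ... | t , e , ds with prepend-multipliable k l ds
  ... | v , ev , dvs = v , trans (evalS′-∷ k l q ws e) ev , multipliers-shrink (≤⇒≤′ n≤k) dvs

  word-in-class : ∀ n p ws → n ≤ proj₁ p → IncreasingFrom p ws → SuffixesIn′ A 𝒜 F p ws →
                  ∃ λ t → evalS′ 𝒮 x p ws ≡ just t × class (stage n) (evalA′ A 𝒜 p ws) t
  word-in-class n (k , l) [] n≤k _ 𝒜l∈F with in-class (good k) l 𝒜l∈F
  ... | t , e , t∈C = t , e , class-shrink (≤⇒≤′ n≤k) t∈C
  word-in-class n (k , l) (q ∷ ws) n≤k (k<q , inc) (w∈F , sufs)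
    with word-in-class (suc k) q ws k<q inc sufs
  ... | t , e , t∈C with proj₂ t∈C l w∈F
  ... | v , ev , v∈C = v , trans (evalS′-∷ k l q ws e) ev , class-shrink (≤⇒≤′ n≤k) v∈C

  basic : Basic 𝒮 x
  basic (p ∷ ws) inc = let (t , e , _) = word-multipliable 0 p ws z≤n inc in t , e

  tame : Tame A 𝒜 𝒮 F c x
  tame (p ∷ ws) (p′ ∷ ws′) inc inc′ suf suf′ same s s′ es es′
    with word-in-class 0 p ws z≤n inc suf | word-in-class 0 p′ ws′ z≤n inc′ suf′
  ... | t , e , ct | t′ , e′ , ct′ = begin
    c s                           ≡⟨ cong c (just-injective (trans (sym es) e)) ⟩
    c t                           ≡⟨ ct ⟩
    colour (evalA A 𝒜 (p ∷ ws))   ≡⟨ cong colour same ⟩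
    colour (evalA A 𝒜 (p′ ∷ ws′)) ≡⟨ sym ct′ ⟩
    c t′                          ≡⟨ cong c (just-injective (trans (sym e′) es′)) ⟩
    c s′                          ∎
    where open ≡-Reasoning

corollary3p4 : ∀ {m : ℕ} (A : Semigroup) (𝒜 : PointArray A m)
                 (S : PartialSemigroup) (𝒮 : FunctionArray S m)
                 (h : Homomorphism A 𝒜 𝒮)
                 (F : List (Semigroup.Carrier A))
                 (D : FunctionArray.Base 𝒮 → Set) →
                 mem (ultX (point h)) D →
                 ∀ (r : ℕ) (c : PartialSemigroup.Carrier S → Fin r) →
                 ∃ λ (x : ℕ → FunctionArray.Base 𝒮) →
                   (∀ n → D (x n)) × Basic 𝒮 x × Tame A 𝒜 𝒮 F c x
corollary3p4 A 𝒜 S 𝒮 h F D D∈f• r c =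
  x , (λ n → pick∈D (stage n)) , basic , tame
  where open Construction A 𝒜 S 𝒮 h F D D∈f• c
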